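{- Let $G$ be a finite simple $2$-connected graph and let $C$ be a cycle of odd length in $G$. Then every edge $e \in E(G) \setminus E(C)$ is contained in a cycle of even length in $G$.
   Context: Graphs are finite, simple (no loops, no multiple edges). A graph is $2$-connected if it has more than $2$ vertices and remains connected whenever fewer than $2$ vertices are removed. The length of a cycle is its number of edges; a cycle is odd (even) if its length is odd (even). -}

module Defs where

open import Data.Nat using (ℕ; zero; suc; _≤_; _<_)
open import Data.Fin using (Fin; zero; suc; fromℕ; inject₁)
open import Data.Bool using (Bool; true; false)
open import Data.Product using (Σ; _×_; _,_)
open import Data.Sum using (_⊎_)
open import Data.Unit using (⊤)
open import Function.Definitions using (Injective)
open import Relation.Binary.PropositionalEquality using (_≡_; _≢_)

record Graph (n : ℕ) : Set where
  field
    adj    : Fin n → Fin n → Bool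
    sym    : ∀ u v → adj u v ≡ adj v u
    irrefl : ∀ v → adj v v ≡ false

open Graph public

Adj : ∀ {n} → Graph n → Fin n → Fin n → Set
Adj G u v = adj G u v ≡ true

-- Walks from u to v in G all of whose vertices satisfy the predicate P
-- (i.e. walks in the subgraph induced by the vertices satisfying P).
data WalkIn {n} (G : Graph n) (P : Fin n → Set) : Fin n → Fin n → Set where
  here : ∀ {v} → P v → WalkIn G P v v
  step : ∀ {u w v} → P u → Adj G u w → WalkIn G P w v → WalkIn G P u v

Connected : ∀ {n} → Graph n → Set
Connected G = ∀ u v → WalkIn G (λ _ → ⊤) u v

-- 2-connected: more than 2 vertices, and G - X is connected for every set X
-- of fewer than 2 vertices (X = ∅ or X = {x}).
TwoConnected : ∀ {n} → Graph n → Set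
TwoConnected {n} G =
  2 < n × Connected G ×
  (∀ x u v → u ≢ x → v ≢ x → WalkIn G (λ y → y ≢ x) u v)

record Cycle {n} (G : Graph n) : Set where
  field
    m       : ℕ
    long    : 3 ≤ suc m
    vert    : Fin (suc m) → Fin n
    inj     : Injective _≡_ _≡_ vert
    adjNext : ∀ (i : Fin m) → Adj G (vert (inject₁ i)) (vert (suc i))
    adjLast : Adj G (vert (fromℕ m)) (vert zero)

  len : ℕ
  len = suc m

open Cycle public

SamePair : ∀ {n} → Fin n → Fin n → Fin n → Fin n → Set
SamePair a b u v = (a ≡ u × b ≡ v) ⊎ (a ≡ v × b ≡ u)

EdgeOf : ∀ {n} {G : Graph n} → Cycle G → Fin n → Fin n → Set
EdgeOf C u v =
  Σ (Fin (m C)) (λ i → SamePair (vert C (inject₁ i)) (vert C (suc i)) u v)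
  ⊎ SamePair (vert C (fromℕ (m C))) (vert C zero) u v

-- A leg is a path that starts on C and then leaves C for good. An ear through an edge uv is
-- a pair of vertex-disjoint legs ending at u and at v; with uv they form a path P between two
-- distinct vertices a, b of C whose interior avoids C. Together with each of the two a–b arcs
-- of C, P closes up to a cycle through uv, and the two lengths add up to |C| + 2|P|, which is
-- odd, so one of them is even. (If P is the single edge ab and an arc is empty, then uv would
-- be an edge of C.)
-- Ears exist by 2-connectivity: every vertex x′ carries a fan, two legs meeting only at x′,
-- built along a walk to C. For a neighbour x ∉ C of x′, walk from x to C avoiding x′; at the
-- first vertex of this walk that lies on C or on the fan, cut back the leg it hits and follow
-- the walk back to x. The result is a leg to x disjoint from one of the two legs of the fan.

module Submission where

open import Defs

open import Data.Empty using (⊥; ⊥-elim)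
open import Data.Fin using (Fin; zero; suc; inject₁; fromℕ)
import Data.Fin
open import Data.List using (List; []; _∷_; _++_; [_]; reverse; _ʳ++_; tabulate; lookup; length)
open import Data.List.Properties
  using (++-assoc; ∷ʳ-++; ++-conicalˡ; ++-conicalʳ; ∷-injectiveˡ; ∷-injectiveʳ; reverse-++; unfold-reverse;
         reverse-involutive; tabulate-lookup; length-tabulate; length-++; length-++-sucʳ; length-++-comm;
         length-reverse)
open import Data.List.Membership.Propositional using (_∈_; _∉_)
open import Data.List.Membership.Propositional.Properties
  using (∈-++⁺ˡ; ∈-++⁺ʳ; ∈-++⁻; ∈-lookup; ∈-∃++; ∈-tabulate⁺)
open import Data.List.Relation.Binary.Disjoint.Propositional using (Disjoint)
import Data.List.Relation.Binary.Disjoint.Propositional.Properties as Disjoint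
open import Data.List.Relation.Binary.Subset.Propositional using (_⊆_)
open import Data.List.Relation.Unary.All.Properties using (¬Any⇒All¬; All¬⇒¬Any)
open import Data.List.Relation.Unary.Any using (here; there)
import Data.List.Relation.Unary.Any.Properties as Any
open import Data.List.Relation.Unary.Linked using (Linked; []; [-]; _∷_)
open import Data.List.Relation.Unary.Unique.Propositional using (Unique; []; _∷_)
import Data.List.Relation.Unary.Unique.Propositional.Properties as Unique
open import Data.Nat using (ℕ; zero; suc; _+_; _*_; _%_; _≤_; s≤s; z≤n)
open import Data.Nat.DivMod using (m%n<n; %-distribˡ-+)
open import Data.Nat.Divisibility using (_∣_; _∣?_; m%n≡0⇒n∣m; ∣m+n∣m⇒∣n; m∣m*n)
open import Data.Nat.Properties using (+-comm)
open import Data.Nat.Tactic.RingSolver using (solve-∀)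
open import Data.Product using (Σ; ∃; ∃₂; _×_; _,_; proj₁; proj₂)
open import Data.Sum using (_⊎_; inj₁; inj₂; [_,_]′)
import Data.Sum as Sum
open import Data.Unit using (⊤)
open import Function using (_∘_)
open import Function.Definitions using (Injective)
open import Relation.Binary.Definitions using (Symmetric)
open import Relation.Binary.PropositionalEquality using (_≡_; _≢_; refl; cong; cong₂; subst)
import Relation.Binary.PropositionalEquality as ≡
open ≡ using (module ≡-Reasoning)
open import Relation.Nullary using (¬_; yes; no)
open import Relation.Nullary.Decidable using (_⊎-dec_)

-- Lists

module _ {A : Set} where

  Unique-∷ : ∀ {x : A} {xs} → x ∉ xs → Unique xs → Unique (x ∷ xs)
  Unique-∷ {xs = xs} x∉xs u = ¬Any⇒All¬ xs x∉xs ∷ u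

  Unique-∷⁻ : ∀ {x : A} {xs} → Unique (x ∷ xs) → x ∉ xs
  Unique-∷⁻ = Unique.Unique[x∷xs]⇒x∉xs

  Unique-++⁻ : ∀ xs {ys : List A} → Unique (xs ++ ys) → Unique xs × Unique ys × Disjoint xs ys
  Unique-++⁻ []       u        = [] , u , λ ()
  Unique-++⁻ (x ∷ xs) (x∉ ∷ u) with Unique-++⁻ xs u
  ... | uxs , uys , xs#ys =
    Unique-∷ (x∉xs++ys ∘ ∈-++⁺ˡ) uxs , uys ,
    λ { (here refl , v∈ys)  → x∉xs++ys (∈-++⁺ʳ xs v∈ys)
      ; (there v∈xs , v∈ys) → xs#ys (v∈xs , v∈ys) }
    where
      x∉xs++ys : x ∉ xs ++ _
      x∉xs++ys = All¬⇒¬Any x∉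

  Unique-swap : ∀ xs {ys : List A} → Unique (xs ++ ys) → Unique (ys ++ xs)
  Unique-swap xs u with Unique-++⁻ xs u
  ... | uxs , uys , xs#ys = Unique.++⁺ uys uxs (Disjoint.sym xs#ys)

  Unique-reverse : ∀ {xs : List A} → Unique xs → Unique (reverse xs)
  Unique-reverse {[]}     u        = u
  Unique-reverse {x ∷ xs} (x∉ ∷ u) rewrite unfold-reverse x xs =
    Unique.++⁺ (Unique-reverse u) (Unique-∷ (λ ()) [])
      λ { (v∈ , here refl) → All¬⇒¬Any x∉ (Any.reverse⁻ v∈) }

  Unique-glue : ∀ {a b : A} {xs ys} → Unique (a ∷ xs ++ [ b ]) → Unique (b ∷ ys ++ [ a ]) →
                Disjoint xs ys → Unique (a ∷ xs ++ b ∷ ys)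
  Unique-glue {a} {b} {xs} {ys} u v xs#ys with Unique-++⁻ (a ∷ xs) u | Unique-++⁻ (b ∷ ys) v
  ... | u₁ , _ , a∷xs#b | v₁ , _ , b∷ys#a = Unique.++⁺ u₁ v₁ disjoint
    where
      disjoint : Disjoint (a ∷ xs) (b ∷ ys)
      disjoint (p         , here refl) = a∷xs#b (p , here refl)
      disjoint (here refl , there q)   = b∷ys#a (there q , here refl)
      disjoint (there p   , there q)   = xs#ys (p , q)

  lookup-injective : ∀ {xs : List A} → Unique xs → Injective _≡_ _≡_ (lookup xs)
  lookup-injective {x ∷ xs} _        {zero}  {zero}  _  = refl
  lookup-injective {x ∷ xs} (x∉ ∷ _) {zero}  {suc j} eq =
    ⊥-elim (All¬⇒¬Any x∉ (subst (_∈ xs) (≡.sym eq) (∈-lookup j)))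
  lookup-injective {x ∷ xs} (x∉ ∷ _) {suc i} {zero}  eq =
    ⊥-elim (All¬⇒¬Any x∉ (subst (_∈ xs) eq (∈-lookup i)))
  lookup-injective {x ∷ xs} (_ ∷ u)  {suc i} {suc j} eq = cong suc (lookup-injective u eq)

  reverse≡[] : ∀ {xs : List A} → reverse xs ≡ [] → xs ≡ []
  reverse≡[] {xs} e = ≡.trans (≡.sym (reverse-involutive xs)) (cong reverse e)

  reverse-ends : ∀ (x : A) xs y → reverse (x ∷ xs ++ [ y ]) ≡ y ∷ reverse xs ++ [ x ]
  reverse-ends x xs y = begin
    reverse (x ∷ xs ++ [ y ])       ≡⟨ unfold-reverse x (xs ++ [ y ]) ⟩
    reverse (xs ++ [ y ]) ++ [ x ]  ≡⟨ cong (_++ [ x ]) (reverse-++ xs [ y ]) ⟩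
    y ∷ reverse xs ++ [ x ]         ∎
    where open ≡-Reasoning

  2≤length-++-∷ : ∀ xs {y : A} ys → (xs ≡ [] → ys ≡ [] → ⊥) → 2 ≤ length (xs ++ y ∷ ys)
  2≤length-++-∷ []       []      nontrivial = ⊥-elim (nontrivial refl refl)
  2≤length-++-∷ []       (_ ∷ _) _          = s≤s (s≤s z≤n)
  2≤length-++-∷ (_ ∷ xs) {y} ys  _          =
    s≤s (subst (1 ≤_) (≡.sym (length-++-sucʳ xs y ys)) (s≤s z≤n))

  Consecutive : A → A → List A → Set
  Consecutive x y zs = ∃₂ λ (xs ys : List A) → zs ≡ xs ++ x ∷ y ∷ ys

  Consecutive-++ : ∀ {x y : A} {xs} ys → Consecutive x y xs → Consecutive x y (xs ++ ys)
  Consecutive-++ zs (xs , ys , refl) = xs , ys ++ zs , ++-assoc xs (_ ∷ _ ∷ ys) zs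

  consecutive-tabulate : ∀ {m} (f : Fin (suc m) → A) {e x y} → Consecutive x y (tabulate f ++ [ e ]) →
                         (∃ λ i → f (inject₁ i) ≡ x × f (suc i) ≡ y) ⊎ (f (fromℕ m) ≡ x × e ≡ y)
  consecutive-tabulate {zero}  f ([]     , _  , refl) = inj₂ (refl , refl)
  consecutive-tabulate {zero}  f (_ ∷ xs , _  , eq)   = ⊥-elim (no-pair xs (∷-injectiveʳ eq))
    where
      no-pair : ∀ {e x y : A} xs {ys} → [ e ] ≢ xs ++ x ∷ y ∷ ys
      no-pair []          ()
      no-pair (_ ∷ [])    ()
      no-pair (_ ∷ _ ∷ _) ()
  consecutive-tabulate {suc m} f ([]     , _  , refl) = inj₁ (zero , refl , refl)
  consecutive-tabulate {suc m} f (_ ∷ xs , ys , eq)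
    with consecutive-tabulate (f ∘ suc) (xs , ys , ∷-injectiveʳ eq)
  ... | inj₁ (i , fi , fsi) = inj₁ (suc i , fi , fsi)
  ... | inj₂ last           = inj₂ last

  Between : A → A → List A → Set
  Between x y zs = ∃₂ λ xs ys → ∃ λ ws → zs ≡ xs ++ x ∷ ys ++ y ∷ ws

  ∈-order : ∀ {x y : A} {zs} → x ∈ zs → y ∈ zs → x ≢ y → Between x y zs ⊎ Between y x zs
  ∈-order {x} {y} x∈ y∈ x≢y with ∈-∃++ x∈
  ... | xs , ys , refl with ∈-++⁻ xs y∈
  ... | inj₂ (here y≡x)   = ⊥-elim (x≢y (≡.sym y≡x))
  ... | inj₂ (there y∈ys) with ∈-∃++ y∈ys
  ...   | ys₁ , ys₂ , refl = inj₁ (xs , ys₁ , ys₂ , refl)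
  ∈-order {x} {y} x∈ y∈ x≢y | xs , ys , refl | inj₁ y∈xs with ∈-∃++ y∈xs
  ...   | xs₁ , xs₂ , refl = inj₂ (xs₁ , xs₂ , ys , ++-assoc xs₁ (y ∷ xs₂) (x ∷ ys))

  module _ {R : A → A → Set} where

    Linked-join : ∀ xs {y ys} → Linked R (xs ++ [ y ]) → Linked R (y ∷ ys) → Linked R (xs ++ y ∷ ys)
    Linked-join []           _        l = l
    Linked-join (_ ∷ [])     (r ∷ _)  l = r ∷ l
    Linked-join (_ ∷ _ ∷ xs) (r ∷ l′) l = r ∷ Linked-join (_ ∷ xs) l′ l

    Linked-split : ∀ xs {y ys} → Linked R (xs ++ y ∷ ys) → Linked R (xs ++ [ y ]) × Linked R (y ∷ ys)
    Linked-split []           l       = [-] , l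
    Linked-split (_ ∷ [])     (r ∷ l) = r ∷ [-] , l
    Linked-split (_ ∷ _ ∷ xs) (r ∷ l) with Linked-split (_ ∷ xs) l
    ... | l₁ , l₂ = r ∷ l₁ , l₂

    Linked-reverse : Symmetric R → ∀ {xs} → Linked R xs → Linked R (reverse xs)
    Linked-reverse R-sym []       = []
    Linked-reverse R-sym {x ∷ xs} l = go xs l [-]
      where
        go : ∀ {x} xs {acc} → Linked R (x ∷ xs) → Linked R (x ∷ acc) → Linked R (xs ʳ++ x ∷ acc)
        go []       _       lacc = lacc
        go (y ∷ ys) (r ∷ l) lacc = go ys l (R-sym r ∷ lacc)

    Linked-rotate : ∀ xs {h t y ys} → h ∷ t ≡ xs ++ y ∷ ys → Linked R (h ∷ t ++ [ h ]) →
                    Linked R (y ∷ ys ++ xs ++ [ y ])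
    Linked-rotate []       refl l = l
    Linked-rotate (x ∷ xs) {y = y} {ys} refl l
      with Linked-split (x ∷ xs) (subst (λ zs → Linked R (x ∷ zs)) (++-assoc xs (y ∷ ys) [ x ]) l)
    ... | l₁ , l₂ = Linked-join (y ∷ ys) l₂ l₁

    linked-tabulate⁺ : ∀ {m} (f : Fin (suc m) → A) {e} → (∀ i → R (f (inject₁ i)) (f (suc i))) →
                       R (f (fromℕ m)) e → Linked R (tabulate f ++ [ e ])
    linked-tabulate⁺ {zero}  f next last = last ∷ [-]
    linked-tabulate⁺ {suc m} f next last = next zero ∷ linked-tabulate⁺ (f ∘ suc) (next ∘ suc) last

    linked-tabulate⁻ : ∀ {m} (f : Fin (suc m) → A) {e} → Linked R (tabulate f ++ [ e ]) →
                       (∀ i → R (f (inject₁ i)) (f (suc i))) × R (f (fromℕ m)) e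
    linked-tabulate⁻ {zero}  f (r ∷ [-]) = (λ ()) , r
    linked-tabulate⁻ {suc m} f (r ∷ l) with linked-tabulate⁻ (f ∘ suc) l
    ... | next , last = (λ { zero → r ; (suc i) → next i }) , last

  record Path (R : A → A → Set) (x : A) (interior : List A) (y : A) : Set where
    field
      unique : Unique (x ∷ interior ++ [ y ])
      linked : Linked R (x ∷ interior ++ [ y ])

  module _ {R : A → A → Set} where

    Path-reverse : Symmetric R → ∀ {x xs y} → Path R x xs y → Path R y (reverse xs) x
    Path-reverse R-sym {x} {xs} {y} p = record
      { unique = subst Unique (reverse-ends x xs y) (Unique-reverse (Path.unique p))
      ; linked = subst (Linked R) (reverse-ends x xs y) (Linked-reverse R-sym (Path.linked p))
      }

    closed-split : ∀ {a b} xs ys → Unique (a ∷ xs ++ b ∷ ys) → Linked R (a ∷ xs ++ b ∷ ys ++ [ a ]) →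
                   Path R a xs b × Path R b ys a
    closed-split {a} {b} xs ys u l = record { unique = u₁ ; linked = proj₁ l₁₂ } ,
                                     record { unique = u₂ ; linked = proj₂ l₁₂ }
      where
        l₁₂ : Linked R (a ∷ xs ++ [ b ]) × Linked R (b ∷ ys ++ [ a ])
        l₁₂ = Linked-split (a ∷ xs) l
        u₁ : Unique (a ∷ xs ++ [ b ])
        u₁ = proj₁ (Unique-++⁻ (a ∷ xs ++ [ b ]) (subst Unique (≡.sym (cong (a ∷_) (∷ʳ-++ xs b ys))) u))
        u₂ : Unique (b ∷ ys ++ [ a ])
        u₂ = proj₁ (Unique-++⁻ (b ∷ ys ++ [ a ])
               (subst Unique (≡.sym (cong (b ∷_) (∷ʳ-++ ys a xs))) (Unique-swap (a ∷ xs) u)))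

-- Parity

odd-residue : ∀ m → ¬ 2 ∣ m → m % 2 ≡ 1
odd-residue m odd with m % 2 in eq | m%n<n m 2
... | 0           | _            = ⊥-elim (odd (m%n≡0⇒n∣m m 2 eq))
... | 1           | _            = refl
... | suc (suc _) | s≤s (s≤s ())

odd+odd : ∀ m n → ¬ 2 ∣ m → ¬ 2 ∣ n → 2 ∣ m + n
odd+odd m n odd-m odd-n = m%n≡0⇒n∣m (m + n) 2 (begin
  (m + n) % 2          ≡⟨ %-distribˡ-+ m n 2 ⟩
  (m % 2 + n % 2) % 2  ≡⟨ cong₂ (λ i j → (i + j) % 2) (odd-residue m odd-m) (odd-residue n odd-n) ⟩
  0                    ∎)
  where open ≡-Reasoning

parity-split : ∀ p q r → ¬ 2 ∣ 2 + (q + r) → 2 ∣ 2 + (p + q) ⊎ 2 ∣ 2 + (p + r)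
parity-split p q r odd with 2 ∣? 2 + (p + q) | 2 ∣? 2 + (p + r)
... | yes even | _        = inj₁ even
... | no _     | yes even = inj₂ even
... | no odd₁  | no odd₂  =
  ⊥-elim (odd (∣m+n∣m⇒∣n (subst (2 ∣_) (sum≡ p q r) (odd+odd _ _ odd₁ odd₂)) (m∣m*n (suc p))))
  where
    sum≡ : ∀ p q r → (2 + (p + q)) + (2 + (p + r)) ≡ 2 * suc p + (2 + (q + r))
    sum≡ = solve-∀

-- Cycles as lists of vertices

module _ {n : ℕ} (G : Graph n) where

  adj-sym : Symmetric (Adj G)
  adj-sym {x} {y} = ≡.trans (sym G y x)

  adj≢ : ∀ {x y} → Adj G x y → x ≢ y
  adj≢ {x} xy refl with ≡.trans (≡.sym xy) (irrefl G x)
  ... | ()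

module _ {n : ℕ} {G : Graph n} where

  walk-start : ∀ {P u v} → WalkIn G P u v → P u
  walk-start (here p)     = p
  walk-start (step p _ _) = p

  SamePair-sym : ∀ {a b x y : Fin n} → SamePair a b x y → SamePair a b y x
  SamePair-sym (inj₁ (ex , ey)) = inj₂ (ex , ey)
  SamePair-sym (inj₂ (ey , ex)) = inj₁ (ey , ex)

  EdgeOf-sym : ∀ (C : Cycle G) {x y} → EdgeOf C x y → EdgeOf C y x
  EdgeOf-sym C (inj₁ (i , p)) = inj₁ (i , SamePair-sym p)
  EdgeOf-sym C (inj₂ p)       = inj₂ (SamePair-sym p)

  cycleVertices : Cycle G → List (Fin n)
  cycleVertices C = tabulate (vert C)

  tour : Cycle G → List (Fin n)
  tour C = cycleVertices C ++ [ vert C zero ]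

  tour-linked : ∀ C → Linked (Adj G) (tour C)
  tour-linked C = linked-tabulate⁺ (vert C) (adjNext C) (adjLast C)

  tour-edge : ∀ C {x y} → Consecutive x y (tour C) → EdgeOf C x y
  tour-edge C xy with consecutive-tabulate (vert C) xy
  ... | inj₁ (i , ex , ey) = inj₁ (i , inj₁ (ex , ey))
  ... | inj₂ (ex , ey)     = inj₂ (inj₁ (ex , ey))

  cycleOf : (c : Fin n) (cs : List (Fin n)) → 2 ≤ length cs → Unique (c ∷ cs) →
            Linked (Adj G) (c ∷ cs ++ [ c ]) → Cycle G
  cycleOf c cs 2≤ u l = record
    { m       = length cs
    ; long    = s≤s 2≤
    ; vert    = lookup (c ∷ cs)
    ; inj     = lookup-injective u
    ; adjNext = proj₁ closed
    ; adjLast = proj₂ closed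
    }
    where
      closed : (∀ i → Adj G (lookup (c ∷ cs) (inject₁ i)) (lookup (c ∷ cs) (suc i))) ×
               Adj G (lookup (c ∷ cs) (fromℕ (length cs))) c
      closed = linked-tabulate⁻ (lookup (c ∷ cs))
                 (subst (λ xs → Linked (Adj G) (xs ++ [ c ])) (≡.sym (tabulate-lookup (c ∷ cs))) l)

  cycleOf-edge : ∀ c cs 2≤ u l {x y} → Consecutive x y (c ∷ cs) → EdgeOf (cycleOf c cs 2≤ u l) x y
  cycleOf-edge c cs 2≤ u l {x} {y} xy =
    tour-edge (cycleOf c cs 2≤ u l)
      (subst (λ xs → Consecutive x y (xs ++ [ c ])) (≡.sym (tabulate-lookup (c ∷ cs))) (Consecutive-++ [ c ] xy))

  cycle-from-paths : ∀ {a b xs ys} → Path (Adj G) a xs b → Path (Adj G) b ys a → Disjoint xs ys →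
                     (xs ≡ [] → ys ≡ [] → ⊥) →
                     Σ (Cycle G) λ D → len D ≡ 2 + (length xs + length ys) ×
                                       (∀ {x y} → Consecutive x y (a ∷ xs ++ [ b ]) → EdgeOf D x y)
  cycle-from-paths {a} {b} {xs} {ys} p q xs#ys nontrivial =
    cycleOf a cs 2≤ u l ,
    cong suc (≡.trans (length-++-sucʳ xs b ys) (cong suc (length-++ xs))) ,
    λ xy → cycleOf-edge a cs 2≤ u l
             (subst (Consecutive _ _) (cong (a ∷_) (∷ʳ-++ xs b ys)) (Consecutive-++ ys xy))
    where
      cs : List (Fin n)
      cs = xs ++ b ∷ ys
      2≤ : 2 ≤ length cs
      2≤ = 2≤length-++-∷ xs ys nontrivial
      u : Unique (a ∷ cs)
      u = Unique-glue (Path.unique p) (Path.unique q) xs#ys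
      l : Linked (Adj G) (a ∷ cs ++ [ a ])
      l = subst (λ zs → Linked (Adj G) (a ∷ zs)) (≡.sym (++-assoc xs (b ∷ ys) [ a ]))
            (Linked-join (a ∷ xs) (Path.linked p) (Path.linked q))

-- Arcs of C

module _ {n : ℕ} {G : Graph n} (C : Cycle G) where

  private
    V : Set
    V = Fin n

  open import Data.List.Membership.DecPropositional (Data.Fin._≟_ {n}) using (_∈?_)

  record Arc (x : V) (interior : List V) (y : V) : Set where
    field
      path  : Path (Adj G) x interior y
      along : interior ⊆ cycleVertices C
      short : interior ≡ [] → EdgeOf C x y

  Arc-reverse : ∀ {x xs y} → Arc x xs y → Arc y (reverse xs) x
  Arc-reverse A = record
    { path  = Path-reverse (adj-sym G) (Arc.path A)
    ; along = Arc.along A ∘ Any.reverse⁻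
    ; short = EdgeOf-sym C ∘ Arc.short A ∘ reverse≡[]
    }

  edge-at : ∀ xs {x y} ys → cycleVertices C ≡ xs ++ x ∷ y ∷ ys → EdgeOf C x y
  edge-at xs {x} {y} ys eq = tour-edge C (xs , ys ++ [ vert C zero ] , (begin
    tour C                                 ≡⟨ cong (_++ [ vert C zero ]) eq ⟩
    (xs ++ x ∷ y ∷ ys) ++ [ vert C zero ]  ≡⟨ ++-assoc xs (x ∷ y ∷ ys) _ ⟩
    xs ++ x ∷ y ∷ ys ++ [ vert C zero ]    ∎))
    where open ≡-Reasoning

  wrap-edge : ∀ {x} xs {y} → cycleVertices C ≡ x ∷ xs ++ [ y ] → EdgeOf C y x
  wrap-edge {x} xs {y} eq = tour-edge C (x ∷ xs , [] , (begin
    tour C                      ≡⟨ cong₂ (λ zs z → zs ++ [ z ]) eq (∷-injectiveˡ eq) ⟩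
    (x ∷ xs ++ [ y ]) ++ [ x ]  ≡⟨ cong (x ∷_) (++-assoc xs [ y ] [ x ]) ⟩
    x ∷ xs ++ y ∷ x ∷ []        ∎))
    where open ≡-Reasoning

  arcs-between : ∀ {a b} → Between a b (cycleVertices C) →
                 ∃₂ λ xs ys → Arc a xs b × Arc b ys a × len C ≡ 2 + (length xs + length ys)
  arcs-between {a} {b} (X , Y , Z , eq) = Y , Z ++ X , arc₁ , arc₂ , length≡
    where
      rotated≡ : (a ∷ Y ++ b ∷ Z) ++ X ≡ a ∷ Y ++ b ∷ Z ++ X
      rotated≡ = cong (a ∷_) (++-assoc Y (b ∷ Z) X)
      unique : Unique (a ∷ Y ++ b ∷ Z ++ X)
      unique = subst Unique rotated≡ (Unique-swap X (subst Unique eq (Unique.tabulate⁺ (inj C))))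
      linked : Linked (Adj G) (a ∷ Y ++ b ∷ (Z ++ X) ++ [ a ])
      linked = subst (λ zs → Linked (Adj G) (a ∷ zs)) (begin
          (Y ++ b ∷ Z) ++ X ++ [ a ]  ≡⟨ ++-assoc Y (b ∷ Z) _ ⟩
          Y ++ b ∷ Z ++ X ++ [ a ]    ≡⟨ cong (λ zs → Y ++ b ∷ zs) (≡.sym (++-assoc Z X [ a ])) ⟩
          Y ++ b ∷ (Z ++ X) ++ [ a ]  ∎)
        (Linked-rotate X eq (tour-linked C))
        where open ≡-Reasoning
      paths : Path (Adj G) a Y b × Path (Adj G) b (Z ++ X) a
      paths = closed-split Y (Z ++ X) unique linked
      on-C : ∀ {v} → v ∈ X ++ a ∷ Y ++ b ∷ Z → v ∈ cycleVertices C
      on-C = subst (_ ∈_) (≡.sym eq)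
      arc₁ : Arc a Y b
      arc₁ = record
        { path  = proj₁ paths
        ; along = λ v∈ → on-C (∈-++⁺ʳ X (there (∈-++⁺ˡ v∈)))
        ; short = λ { refl → edge-at X Z eq }
        }
      arc₂ : Arc b (Z ++ X) a
      arc₂ = record
        { path  = proj₂ paths
        ; along = λ v∈ → on-C ([ (λ v∈Z → ∈-++⁺ʳ X (there (∈-++⁺ʳ Y (there v∈Z)))) , ∈-++⁺ˡ ]′
                                 (∈-++⁻ Z v∈))
        ; short = λ e → wrap-edge Y (≡.trans eq (cong₂ (λ xs zs → xs ++ a ∷ Y ++ b ∷ zs)
                                                       (++-conicalʳ Z X e) (++-conicalˡ Z X e)))
        }
      length≡ : len C ≡ 2 + (length Y + length (Z ++ X))
      length≡ = begin
        len C                             ≡⟨ ≡.sym (length-tabulate (vert C)) ⟩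
        length (cycleVertices C)          ≡⟨ cong length eq ⟩
        length (X ++ a ∷ Y ++ b ∷ Z)      ≡⟨ length-++-comm X _ ⟩
        length ((a ∷ Y ++ b ∷ Z) ++ X)    ≡⟨ cong length rotated≡ ⟩
        suc (length (Y ++ b ∷ Z ++ X))    ≡⟨ cong suc (length-++-sucʳ Y b _) ⟩
        2 + length (Y ++ Z ++ X)          ≡⟨ cong (2 +_) (length-++ Y) ⟩
        2 + (length Y + length (Z ++ X))  ∎
        where open ≡-Reasoning

  arcs : ∀ {a b} → a ∈ cycleVertices C → b ∈ cycleVertices C → a ≢ b →
         ∃₂ λ xs ys → Arc a xs b × Arc b ys a × len C ≡ 2 + (length xs + length ys)
  arcs a∈ b∈ a≢b with ∈-order a∈ b∈ a≢b
  ... | inj₁ a-then-b = arcs-between a-then-b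
  ... | inj₂ b-then-a with arcs-between b-then-a
  ...   | xs , ys , A , B , len≡ = ys , xs , B , A , ≡.trans len≡ (cong (2 +_) (+-comm (length xs) (length ys)))

  off-cycle-disjoint : ∀ {xs ys} → (∀ {v} → v ∈ xs → v ∉ cycleVertices C) → ys ⊆ cycleVertices C →
                       Disjoint xs ys
  off-cycle-disjoint off on (v∈xs , v∈ys) = off v∈xs (on v∈ys)

  even-cycle-via-path : ∀ {a mid b} → Path (Adj G) a mid b →
                        a ∈ cycleVertices C → b ∈ cycleVertices C →
                        (∀ {v} → v ∈ mid → v ∉ cycleVertices C) →
                        (mid ≡ [] → ¬ EdgeOf C a b) → ¬ 2 ∣ len C →
                        Σ (Cycle G) λ D → 2 ∣ len D ×
                                          (∀ {x y} → Consecutive x y (a ∷ mid ++ [ b ]) → EdgeOf D x y)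
  even-cycle-via-path {a} {mid} {b} P a∈C b∈C mid∉C no-chord odd
    with arcs a∈C b∈C (λ { refl → Unique-∷⁻ (Path.unique P) (∈-++⁺ʳ mid (here refl)) })
  ... | Y , W , A , B , len≡
    with cycle-from-paths P (Arc.path B) (off-cycle-disjoint mid∉C (Arc.along B))
           (λ { refl W≡[] → no-chord refl (EdgeOf-sym C (Arc.short B W≡[])) })
       | cycle-from-paths P (Arc.path (Arc-reverse A)) (off-cycle-disjoint mid∉C (Arc.along (Arc-reverse A)))
           (λ { refl Y≡[] → no-chord refl (EdgeOf-sym C (Arc.short (Arc-reverse A) Y≡[])) })
  ... | D₁ , len₁ , edges₁ | D₂ , len₂ , edges₂
    with parity-split (length mid) (length Y) (length W) (subst (λ k → ¬ 2 ∣ k) len≡ odd)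
  ... | inj₁ even₂ =
    D₂ , subst (2 ∣_) (≡.sym (≡.trans len₂ (cong (λ k → 2 + (length mid + k)) (length-reverse Y)))) even₂ ,
    edges₂
  ... | inj₂ even₁ = D₁ , subst (2 ∣_) (≡.sym len₁) even₁ , edges₁

  -- Legs, ears and fans

  -- Leg a x: a path from a ∈ C to its tip x whose other vertices avoid C, listed tip first.
  data Leg (a : V) : V → Set
  vertices : ∀ {a x} → Leg a x → List V
  below : ∀ {a x} → Leg a x → List V

  data Leg a where
    root : a ∈ cycleVertices C → Leg a a
    grow : ∀ {x y} (l : Leg a x) → Adj G y x → y ∉ cycleVertices C → y ∉ vertices l → Leg a y

  vertices {x = x} l = x ∷ below l

  below (root _)       = []
  below (grow l _ _ _) = vertices l

  inner : ∀ {a x} → Leg a x → List V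
  inner (root _)               = []
  inner (grow {y = y} l _ _ _) = y ∷ inner l

  vertices≡inner : ∀ {a x} (l : Leg a x) → vertices l ≡ inner l ++ [ a ]
  vertices≡inner (root _)               = refl
  vertices≡inner (grow {y = y} l _ _ _) = cong (y ∷_) (vertices≡inner l)

  root∈C : ∀ {a x} → Leg a x → a ∈ cycleVertices C
  root∈C (root a∈C)     = a∈C
  root∈C (grow l _ _ _) = root∈C l

  inner∉C : ∀ {a x} (l : Leg a x) {v} → v ∈ inner l → v ∉ cycleVertices C
  inner∉C (grow l _ y∉C _) (here refl) = y∉C
  inner∉C (grow l _ _ _)   (there v∈)  = inner∉C l v∈

  inner≡[] : ∀ {a x} (l : Leg a x) → inner l ≡ [] → x ≡ a
  inner≡[] (root _) _ = refl

  vertices-unique : ∀ {a x} (l : Leg a x) → Unique (vertices l)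
  vertices-unique (root _)         = Unique-∷ (λ ()) []
  vertices-unique (grow l _ _ y∉l) = Unique-∷ y∉l (vertices-unique l)

  vertices-linked : ∀ {a x} (l : Leg a x) → Linked (Adj G) (vertices l)
  vertices-linked (root _)        = [-]
  vertices-linked (grow l yx _ _) = yx ∷ vertices-linked l

  cut : ∀ {a x z} (l : Leg a x) → z ∈ vertices l → Σ (Leg a z) λ k → vertices k ⊆ vertices l
  cut l              (here refl) = l , λ v∈ → v∈
  cut (grow l _ _ _) (there z∈)  with cut l z∈
  ... | k , k⊆l = k , there ∘ k⊆l

  cut-below : ∀ {a x z} (l : Leg a x) → z ∈ vertices l → z ≢ x →
              Σ (Leg a z) λ k → vertices k ⊆ vertices l × x ∉ vertices k
  cut-below l                (here refl) z≢x = ⊥-elim (z≢x refl)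
  cut-below (grow l _ _ x∉l) (there z∈)  _   with cut l z∈
  ... | k , k⊆l = k , there ∘ k⊆l , x∉l ∘ k⊆l

  record Ear (u v : V) : Set where
    field
      {start end} : V
      left        : Leg start u
      right       : Leg end v
      disjoint    : Disjoint (vertices left) (vertices right)

    interior : List V
    interior = reverse (inner left) ++ inner right

  Ear-swap : ∀ {u v} → Ear u v → Ear v u
  Ear-swap e = record { left = Ear.right e ; right = Ear.left e ; disjoint = λ (p , q) → Ear.disjoint e (q , p) }

  module _ {u v} (uv : Adj G u v) (e : Ear u v) where
    open Ear e

    private
      trail : List V
      trail = reverse (vertices left) ++ vertices right

      trail≡ends : trail ≡ start ∷ interior ++ [ end ]
      trail≡ends = begin
        reverse (vertices left) ++ vertices right
          ≡⟨ cong₂ (λ xs ys → reverse xs ++ ys) (vertices≡inner left) (vertices≡inner right) ⟩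
        reverse (inner left ++ [ start ]) ++ inner right ++ [ end ]
          ≡⟨ cong (_++ inner right ++ [ end ]) (reverse-++ (inner left) [ start ]) ⟩
        start ∷ reverse (inner left) ++ inner right ++ [ end ]
          ≡⟨ cong (start ∷_) (≡.sym (++-assoc (reverse (inner left)) (inner right) [ end ])) ⟩
        start ∷ interior ++ [ end ]
          ∎
        where open ≡-Reasoning

      trail≡tips : trail ≡ reverse (below left) ++ u ∷ v ∷ below right
      trail≡tips = ≡.trans (cong (_++ vertices right) (unfold-reverse u (below left)))
                           (∷ʳ-++ (reverse (below left)) u _)

    ear-path : Path (Adj G) start interior end
    ear-path = record
      { unique = subst Unique trail≡ends
          (Unique.++⁺ (Unique-reverse (vertices-unique left)) (vertices-unique right)
                      (λ (p , q) → disjoint (Any.reverse⁻ p , q)))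
      ; linked = subst (Linked (Adj G)) (≡.trans (≡.sym trail≡tips) trail≡ends)
          (Linked-join (reverse (below left))
             (subst (Linked (Adj G)) (unfold-reverse u (below left))
                    (Linked-reverse (adj-sym G) (vertices-linked left)))
             (uv ∷ vertices-linked right))
      }

    ear-consecutive : Consecutive u v (start ∷ interior ++ [ end ])
    ear-consecutive = reverse (below left) , below right , ≡.trans (≡.sym trail≡ends) trail≡tips

  interior∉C : ∀ {u v} (e : Ear u v) {w} → w ∈ Ear.interior e → w ∉ cycleVertices C
  interior∉C e w∈ with ∈-++⁻ (reverse (inner (Ear.left e))) w∈
  ... | inj₁ w∈l = inner∉C (Ear.left e) (Any.reverse⁻ w∈l)
  ... | inj₂ w∈r = inner∉C (Ear.right e) w∈r

  interior≡[] : ∀ {u v} (e : Ear u v) → Ear.interior e ≡ [] → u ≡ Ear.start e × v ≡ Ear.end e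
  interior≡[] e empty =
    inner≡[] (Ear.left e) (reverse≡[] (++-conicalˡ _ _ empty)) , inner≡[] (Ear.right e) (++-conicalʳ _ _ empty)

  even-cycle-via-ear : ∀ {u v} → Adj G u v → Ear u v → ¬ EdgeOf C u v → ¬ 2 ∣ len C →
                       Σ (Cycle G) λ D → 2 ∣ len D × EdgeOf D u v
  even-cycle-via-ear uv e uv∉C odd =
    let D , even , edges = even-cycle-via-path (ear-path uv e) (root∈C (Ear.left e)) (root∈C (Ear.right e))
                                               (interior∉C e) no-chord odd
    in D , even , edges (ear-consecutive uv e)
    where
      no-chord : Ear.interior e ≡ [] → ¬ EdgeOf C (Ear.start e) (Ear.end e)
      no-chord empty with interior≡[] e empty
      ... | refl , refl = uv∉C

  record Fan (x : V) : Set where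
    field
      {start end} : V
      left        : Leg start x
      right       : Leg end x
      meet        : ∀ {y} → y ∈ vertices left → y ∈ vertices right → y ≡ x

  root-fan : ∀ {x} → x ∈ cycleVertices C → Fan x
  root-fan x∈C = record { left = root x∈C ; right = root x∈C ; meet = λ { (here refl) _ → refl } }

  fan-of-ear : ∀ {x x′} → x ∉ cycleVertices C → Adj G x x′ → Ear x x′ → Fan x
  fan-of-ear x∉C xx′ e = record
    { left  = Ear.left e
    ; right = grow (Ear.right e) xx′ x∉C (λ x∈r → Ear.disjoint e (here refl , x∈r))
    ; meet  = λ { _ (here refl) → refl ; y∈l (there y∈r) → ⊥-elim (Ear.disjoint e (y∈l , y∈r)) }
    }

  LegAvoiding : List V → V → Set
  LegAvoiding vs x = Σ V λ a → Σ (Leg a x) λ l → Disjoint (vertices l) vs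

  avoiding-below : ∀ {a x z vs} (l : Leg a x) → z ∈ vertices l → z ≢ x →
                   (∀ {y} → y ∈ vertices l → y ∈ vs → y ≡ x) → LegAvoiding vs z
  avoiding-below l z∈l z≢x meet with cut-below l z∈l z≢x
  ... | k , k⊆l , x∉k = _ , k , λ (y∈k , y∈vs) → x∉k (subst (_∈ vertices k) (meet (k⊆l y∈k) y∈vs) y∈k)

  avoiding-step : ∀ {vs x x₁} → Adj G x x₁ → x ∉ cycleVertices C → x ∉ vs → LegAvoiding vs x₁ →
                  LegAvoiding vs x
  avoiding-step {x = x} xx₁ x∉C x∉vs (a , l , l#vs) with x ∈? vertices l
  ... | yes x∈l = a , proj₁ (cut l x∈l) , λ (p , q) → l#vs (proj₂ (cut l x∈l) p , q)
  ... | no x∉l  = a , grow l xx₁ x∉C x∉l , λ { (here refl , q) → x∉vs q ; (there p , q) → l#vs (p , q) }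

  module _ {x′} (F : Fan x′) where
    open Fan F

    Target : V → Set
    Target z = z ∈ vertices left ⊎ z ∈ vertices right ⊎ z ∈ cycleVertices C

    reroute : ∀ {z} → z ≢ x′ → Target z → LegAvoiding (vertices right) z ⊎ LegAvoiding (vertices left) z
    reroute z≢x′ (inj₁ z∈l)        = inj₁ (avoiding-below left z∈l z≢x′ meet)
    reroute z≢x′ (inj₂ (inj₁ z∈r)) = inj₂ (avoiding-below right z∈r z≢x′ (λ p q → meet q p))
    reroute {z} z≢x′ (inj₂ (inj₂ z∈C)) with z ∈? vertices right
    ... | yes z∈r = inj₂ (avoiding-below right z∈r z≢x′ (λ p q → meet q p))
    ... | no z∉r  = inj₁ (z , root z∈C , λ { (here refl , q) → z∉r q })

    reroute-along : ∀ {z t} → WalkIn G (_≢ x′) z t → Target t →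
                    LegAvoiding (vertices right) z ⊎ LegAvoiding (vertices left) z
    reroute-along {z} w t-target
      with z ∈? vertices left ⊎-dec z ∈? vertices right ⊎-dec z ∈? cycleVertices C
    ... | yes z-target = reroute (walk-start w) z-target
    reroute-along (here _)       t-target | no ¬target = ⊥-elim (¬target t-target)
    reroute-along (step _ zz₁ w) t-target | no ¬target =
      Sum.map (avoiding-step zz₁ (¬target ∘ inj₂ ∘ inj₂) (¬target ∘ inj₂ ∘ inj₁))
              (avoiding-step zz₁ (¬target ∘ inj₂ ∘ inj₂) (¬target ∘ inj₁))
              (reroute-along w t-target)

  other-vertex : ∀ s → Σ V λ t → t ∈ cycleVertices C × t ≢ s
  other-vertex s with vert C zero Data.Fin.≟ s
  ... | no first≢s = vert C zero , ∈-tabulate⁺ {f = vert C} zero , first≢s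
  ... | yes refl   = vert C (fromℕ (m C)) , ∈-tabulate⁺ {f = vert C} (fromℕ (m C)) ,
                     λ last≡first → first≢last (m C) (long C) (inj C (≡.sym last≡first))
    where
      first≢last : ∀ k → 3 ≤ suc k → Fin.zero {k} ≢ fromℕ k
      first≢last zero    (s≤s ())
      first≢last (suc k) _ ()

  module _ (2-connected : TwoConnected G) where

    extend : ∀ {x x′} → x ∉ cycleVertices C → Adj G x x′ → Fan x′ → Ear x x′
    extend {x} {x′} x∉C xx′ F with other-vertex x′
    ... | t , t∈C , t≢x′
      with reroute-along F (proj₂ (proj₂ 2-connected) x′ x t (adj≢ G xx′) t≢x′) (inj₂ (inj₂ t∈C))
    ...   | inj₁ (_ , l , l#r) = record { left = l ; right = Fan.right F ; disjoint = l#r }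
    ...   | inj₂ (_ , l , l#l) = record { left = l ; right = Fan.left F ; disjoint = l#l }

    fan : ∀ x → Fan x
    fan x = along (proj₁ (proj₂ 2-connected) x (vert C zero)) (∈-tabulate⁺ {f = vert C} zero)
      where
        along : ∀ {y t} → WalkIn G (λ _ → ⊤) y t → t ∈ cycleVertices C → Fan y
        along {y} w t∈C with y ∈? cycleVertices C
        ... | yes y∈C = root-fan y∈C
        along (here _)       t∈C | no y∉C = ⊥-elim (y∉C t∈C)
        along (step _ yy₁ w) t∈C | no y∉C = fan-of-ear y∉C yy₁ (extend y∉C yy₁ (along w t∈C))

    ear : ∀ {u v} → Adj G u v → Ear u v
    ear {u} {v} uv with u ∈? cycleVertices C | v ∈? cycleVertices C
    ... | no u∉C  | _       = extend u∉C uv (fan v)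
    ... | yes _   | no v∉C  = Ear-swap (extend v∉C (adj-sym G uv) (fan u))
    ... | yes u∈C | yes v∈C =
      record { left = root u∈C ; right = root v∈C ; disjoint = λ { (here refl , here refl) → adj≢ G uv refl } }

theorem1 : ∀ {n : ℕ} (G : Graph n) → TwoConnected G →
    (C : Cycle G) → ¬ (2 ∣ len C) →
    ∀ (u v : Fin n) → Adj G u v → ¬ EdgeOf C u v →
    Σ (Cycle G) (λ D → (2 ∣ len D) × EdgeOf D u v)
theorem1 G 2-connected C odd u v uv uv∉C = even-cycle-via-ear C uv (ear C 2-connected uv) uv∉C odd
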